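{- Let $H(V,E)$ be the complete $r$-uniform hypergraph with $n$ vertices ($1\le r\le n$). If $r>\lfloor n/2\rfloor$, then the total edge-domatic number of $H$ is $ed_t(H)=\left\lfloor \binom{n}{r}/2\right\rfloor$.
   Context: A hypergraph $H(V,E)$ has a finite vertex set $V$ and a set $E$ of hyperedges, each a subset of $V$; it is $r$-uniform if every hyperedge has exactly $r$ vertices. The complete $r$-uniform hypergraph on $n$ vertices has as hyperedges all $r$-element subsets of $V$. Two distinct hyperedges are adjacent if they share at least one vertex; a hyperedge is not adjacent to itself. A total edge-dominating set is a subset $E_t\subseteq E$ such that every hyperedge in $E$ is adjacent to some hyperedge in $E_t$. The total edge-domatic number $ed_t(H)$ is the maximum number of classes in a partition of $E$ into total edge-dominating sets. -}

module Defs where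

open import Data.Nat using (ℕ; zero; _≤_; _≡ᵇ_)
open import Data.Fin using (Fin)
open import Data.Fin.Subset using (Subset; _∩_; Nonempty; ∣_∣)
open import Data.Product using (Σ; ∃; _×_; proj₁)
open import Data.Sum using (_⊎_)
open import Relation.Binary.PropositionalEquality using (_≡_; _≢_)

Hypergraph : ℕ → Set₁
Hypergraph n = Subset n → Set

Edge : ∀ {n} → Hypergraph n → Set
Edge {n} H = Σ (Subset n) H

Complete : (n r : ℕ) → Hypergraph n
Complete n r s = ∣ s ∣ ≡ r

Adjacent : ∀ {n} {H : Hypergraph n} → Edge H → Edge H → Set
Adjacent e f = (proj₁ e ≢ proj₁ f) × Nonempty (proj₁ e ∩ proj₁ f)

TotalEdgeDominating : ∀ {n} (H : Hypergraph n) → (Edge H → Set) → Set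
TotalEdgeDominating H S = ∀ e → ∃ λ f → S f × Adjacent {H = H} e f

-- A partition of E into k classes (class assignment c : E → Fin k),
-- every class being a total edge-dominating set.
-- (Classes are automatically nonempty whenever E is nonempty.)
TEDPartition : ∀ {n} (H : Hypergraph n) → ℕ → Set
TEDPartition H k =
  Σ (Edge H → Fin k) λ c → ∀ (i : Fin k) → TotalEdgeDominating H (λ e → c e ≡ i)

-- d is the total edge-domatic number of H: the maximum number of classes
-- of such a partition (with the convention max ∅ = 0).
IsTotalEdgeDomaticNumber : ∀ {n} (H : Hypergraph n) → ℕ → Set
IsTotalEdgeDomaticNumber H d =
  (d ≡ zero ⊎ TEDPartition H d) × (∀ k → TEDPartition H k → k ≤ d)

-- Every class of a total edge-dominating partition contains two distinct
-- hyperedges (a dominator of some edge and a dominator of that dominator),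
-- so there are at most ⌊C(n,r)/2⌋ classes. Conversely, when 2r > n any two
-- r-subsets meet, so any class containing two distinct hyperedges is total
-- edge-dominating: each hyperedge differs from one of the two and meets it.
-- Numbering the hyperedges and pairing consecutive numbers therefore gives
-- ⌊C(n,r)/2⌋ classes.
module Submission where

open import Defs
open import Data.Nat using (ℕ; _≤_; _<_; _/_)
open import Data.Nat.Combinatorics using (_C_)

open import Data.Bool.Properties using () renaming (_≟_ to _≟ᵇ_)
open import Data.Fin as Fin using (Fin; toℕ; fromℕ<; inject≤; combine; remQuot)
open import Data.Fin.Patterns using (0F; 1F)
open import Data.Fin.Properties
  using ( +↔⊎; *↔×; injective⇒≤; toℕ-injective; toℕ-fromℕ<; toℕ-inject≤; toℕ<n
        ; inject≤-injective; remQuot-combine; combine-injectiveʳ)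
open import Data.Fin.Subset using (Subset; _∩_; Nonempty; ∣_∣; inside; outside; ⊥)
open import Data.Fin.Subset.Properties using (∣⊥∣≡0)
open import Data.Nat using (zero; suc; _+_; _*_; s≤s; s≤s⁻¹; NonZero; _<?_)
open import Data.Nat.Combinatorics using (nCk+nC[k+1]≡[n+1]C[k+1])
open import Data.Nat.DivMod using (m/n*n≤m; m*n/n≡m; /-monoˡ-≤)
open import Data.Nat.Properties
  using ( ≤-trans; n≤1+n; +-suc; suc-injective; ≡-irrelevant; ≰⇒>; <⇒≱; *-comm; +-identityʳ
        ; module ≤-Reasoning)
open import Data.Product using (Σ; _×_; _,_; proj₁; proj₂)
open import Data.Sum using (_⊎_; inj₁; inj₂)
open import Data.Sum.Function.Propositional using (_⊎-↔_)
open import Data.Vec using ([]; _∷_; here; there)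
open import Data.Vec.Properties using (≡-dec)
open import Function using (_∘_; case_of_)
open import Function.Bundles using (_↔_; _↣_; Inverse; Injection; mk↔ₛ′; mk↣)
open import Function.Properties.Inverse using (↔-trans; ↔-sym; ↔⇒↣)
open import Function.Properties.Injection using (↣-trans)
open import Relation.Nullary using (yes; no; contradiction)
open import Relation.Binary.PropositionalEquality

m*n≤o⇒m≤o/n : ∀ m n {o} .{{_ : NonZero n}} → m * n ≤ o → m ≤ o / n
m*n≤o⇒m≤o/n m n {o} m*n≤o = begin
  m          ≡⟨ m*n/n≡m m n ⟨
  m * n / n  ≤⟨ /-monoˡ-≤ n m*n≤o ⟩
  o / n      ∎
  where open ≤-Reasoning

m/n<o⇒m<o*n : ∀ m n {o} .{{_ : NonZero n}} → m / n < o → m < o * n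
m/n<o⇒m<o*n m n {o} m/n<o = ≰⇒> (<⇒≱ m/n<o ∘ m*n≤o⇒m≤o/n o n)

∩-nonempty : ∀ {n} (p q : Subset n) → n < ∣ p ∣ + ∣ q ∣ → Nonempty (p ∩ q)
∩-nonempty []            []            ()
∩-nonempty (inside ∷ p)  (inside ∷ q)  _          = 0F , here
∩-nonempty (inside ∷ p)  (outside ∷ q) (s≤s n<)
  with x , x∈ ← ∩-nonempty p q n<                 = Fin.suc x , there x∈
∩-nonempty {suc n} (outside ∷ p) (inside ∷ q) 1+n<
  with x , x∈ ← ∩-nonempty p q (s≤s⁻¹ (subst (suc n <_) (+-suc ∣ p ∣ ∣ q ∣) 1+n<))
                                                  = Fin.suc x , there x∈
∩-nonempty (outside ∷ p) (outside ∷ q) 1+n<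
  with x , x∈ ← ∩-nonempty p q (≤-trans (n≤1+n _) 1+n<)
                                                  = Fin.suc x , there x∈

∣p∣≡0⇒p≡⊥ : ∀ {n} (p : Subset n) → ∣ p ∣ ≡ 0 → p ≡ ⊥
∣p∣≡0⇒p≡⊥ []            _     = refl
∣p∣≡0⇒p≡⊥ (outside ∷ p) ∣p∣≡0 = cong (outside ∷_) (∣p∣≡0⇒p≡⊥ p ∣p∣≡0)

distinct⇒Fin2↣ : ∀ {A : Set} {x y : A} → x ≢ y → Fin 2 ↣ A
distinct⇒Fin2↣ {A} {x} {y} x≢y = mk↣ injective
  where
  pick : Fin 2 → A
  pick 0F = x
  pick 1F = y

  injective : ∀ {b b′} → pick b ≡ pick b′ → b ≡ b′
  injective {0F} {0F} _   = refl
  injective {1F} {1F} _   = refl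
  injective {0F} {1F} x≡y = contradiction x≡y x≢y
  injective {1F} {0F} y≡x = contradiction (sym y≡x) x≢y

HasTwoElements : ∀ {A : Set} → (A → Set) → Set
HasTwoElements {A} P = Σ (Fin 2 ↣ A) λ two → ∀ b → P (Injection.to two b)

EveryClassHasTwo : ∀ {A : Set} {k} → (A → Fin k) → Set
EveryClassHasTwo c = ∀ i → HasTwoElements (λ x → c x ≡ i)

everyClassHasTwo⇒*2≤ : ∀ {A : Set} {k m} →
                       A ↣ Fin m → (c : A → Fin k) → EveryClassHasTwo c → k * 2 ≤ m
everyClassHasTwo⇒*2≤ {A} {k} {m} A↣Fin[m] c two =
  injective⇒≤ (Injection.injective Fin[k*2]↣Fin[m])
  where
  member : Fin k × Fin 2 → A
  member (i , b) = Injection.to (proj₁ (two i)) b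

  member-injective : ∀ {p q} → member p ≡ member q → p ≡ q
  member-injective {i , b} {j , b′} eq
    with refl ← trans (sym (proj₂ (two i) b)) (trans (cong c eq) (proj₂ (two j) b′))
    = cong (i ,_) (Injection.injective (proj₁ (two i)) eq)

  Fin[k*2]↣Fin[m] : Fin (k * 2) ↣ Fin m
  Fin[k*2]↣Fin[m] = ↣-trans (↔⇒↣ *↔×) (↣-trans (mk↣ member-injective) A↣Fin[m])

module _ {d m} (2[1+d]≤m : suc d * 2 ≤ m) where

  -- Indices 2i and 2i+1 form class i; indices from 2(d+1) on join class 0.
  pairUp : Fin m → Fin (suc d)
  pairUp j with toℕ j <? suc d * 2
  ... | yes j<2[1+d] = proj₁ (remQuot 2 (fromℕ< j<2[1+d]))
  ... | no  _        = 0F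

  pairUp-inject≤ : ∀ x → pairUp (inject≤ x 2[1+d]≤m) ≡ proj₁ (remQuot 2 x)
  pairUp-inject≤ x with toℕ (inject≤ x 2[1+d]≤m) <? suc d * 2
  ... | yes x<2[1+d] = cong (proj₁ ∘ remQuot 2)
                            (toℕ-injective (trans (toℕ-fromℕ< x<2[1+d]) (toℕ-inject≤ x 2[1+d]≤m)))
  ... | no  x≮2[1+d] = contradiction (subst (_< suc d * 2) (sym (toℕ-inject≤ x 2[1+d]≤m)) (toℕ<n x))
                                     x≮2[1+d]

  everyClassHasTwo-pairUp : EveryClassHasTwo pairUp
  everyClassHasTwo-pairUp i = mk↣ member-injective , member-class
    where
    member : Fin 2 → Fin m
    member b = inject≤ (combine i b) 2[1+d]≤m

    member-injective : ∀ {b b′} → member b ≡ member b′ → b ≡ b′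
    member-injective {b} {b′} = combine-injectiveʳ i b i b′ ∘ inject≤-injective _ _ _ _

    member-class : ∀ b → pairUp (member b) ≡ i
    member-class b = trans (pairUp-inject≤ (combine i b)) (cong proj₁ (remQuot-combine i b))

  ↔Fin⇒everyClassHasTwo : ∀ {A : Set} → A ↔ Fin m → Σ (A → Fin (suc d)) EveryClassHasTwo
  ↔Fin⇒everyClassHasTwo A↔Fin[m] = pairUp ∘ to , λ i →
    let two , two∈i = everyClassHasTwo-pairUp i
    in ↣-trans two (↔⇒↣ (↔-sym A↔Fin[m])) , λ b → trans (cong pairUp (to∘from _)) (two∈i b)
    where
    open Inverse A↔Fin[m] using (to) renaming (strictlyInverseˡ to to∘from)

-- An edge is a vertex set paired with a proof that it is a hyperedge; in a
-- simple hypergraph that proof carries no information.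
Simple : ∀ {n} → Hypergraph n → Set
Simple H = ∀ {e f : Edge H} → proj₁ e ≡ proj₁ f → e ≡ f

Intersecting : ∀ {n} → Hypergraph n → Set
Intersecting H = ∀ (e f : Edge H) → Nonempty (proj₁ e ∩ proj₁ f)

module _ {n} {H : Hypergraph n} where

  TotalEdgeDominating⇒HasTwoElements : ∀ {S} → TotalEdgeDominating H S → Edge H → HasTwoElements S
  TotalEdgeDominating⇒HasTwoElements dominating e =
    let a , a∈S , _       = dominating e
        b , b∈S , a≉b , _ = dominating a
    in distinct⇒Fin2↣ (a≉b ∘ cong proj₁) , λ { 0F → a∈S ; 1F → b∈S }

  HasTwoElements⇒TotalEdgeDominating :
    ∀ {S} → Simple H → Intersecting H → HasTwoElements S → TotalEdgeDominating H S
  HasTwoElements⇒TotalEdgeDominating simple meet (two , two∈S) e =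
    case ≡-dec _≟ᵇ_ (proj₁ e) (proj₁ a) of λ where
      (no  e≉a) → a , two∈S 0F , e≉a , meet e a
      (yes e≈a) → b , two∈S 1F , e≈a⇒e≉b e≈a , meet e b
    where
    open Injection two using (to; injective)
    a b : Edge H
    a = to 0F
    b = to 1F

    e≈a⇒e≉b : proj₁ e ≡ proj₁ a → proj₁ e ≢ proj₁ b
    e≈a⇒e≉b e≈a e≈b with () ← injective (simple (trans (sym e≈a) e≈b))

  TEDPartition⇒*2≤ : ∀ {k m} → Edge H ↣ Fin m → Edge H → TEDPartition H k → k * 2 ≤ m
  TEDPartition⇒*2≤ E↣Fin[m] e (c , dominating) =
    everyClassHasTwo⇒*2≤ E↣Fin[m] c (λ i → TotalEdgeDominating⇒HasTwoElements (dominating i) e)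

  TEDPartition-pairUp : ∀ {d m} →
    Simple H → Intersecting H → Edge H ↔ Fin m → suc d * 2 ≤ m → TEDPartition H (suc d)
  TEDPartition-pairUp simple meet E↔Fin[m] 2[1+d]≤m =
    let c , two = ↔Fin⇒everyClassHasTwo 2[1+d]≤m E↔Fin[m]
    in c , λ i → HasTwoElements⇒TotalEdgeDominating simple meet (two i)

-- Pascal's recursion, which the enumeration of r-subsets below follows
-- (_C_ itself is defined through factorials).
binomial : ℕ → ℕ → ℕ
binomial _       zero    = 1
binomial zero    (suc r) = 0
binomial (suc n) (suc r) = binomial n r + binomial n (suc r)

binomial≡C : ∀ n r → binomial n r ≡ n C r
binomial≡C _       zero    = refl
binomial≡C zero    (suc r) = refl
binomial≡C (suc n) (suc r) =
  trans (cong₂ _+_ (binomial≡C n r) (binomial≡C n (suc r))) (nCk+nC[k+1]≡[n+1]C[k+1] n r)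

Complete-simple : ∀ {n r} → Simple (Complete n r)
Complete-simple {e = s , p} {f = .s , q} refl = cong (s ,_) (≡-irrelevant p q)

Complete-intersecting : ∀ {n r} → n < r * 2 → Intersecting (Complete n r)
Complete-intersecting {n} {r} n<2r (s , ∣s∣≡r) (t , ∣t∣≡r) =
  ∩-nonempty s t (subst (n <_) 2r≡∣s∣+∣t∣ n<2r)
  where
  2r≡∣s∣+∣t∣ : r * 2 ≡ ∣ s ∣ + ∣ t ∣
  2r≡∣s∣+∣t∣ = begin
    r * 2          ≡⟨ *-comm r 2 ⟩
    r + (r + 0)    ≡⟨ cong (r +_) (+-identityʳ r) ⟩
    r + r          ≡⟨ cong₂ _+_ ∣s∣≡r ∣t∣≡r ⟨
    ∣ s ∣ + ∣ t ∣  ∎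
    where open ≡-Reasoning

Complete[n,0]↔Fin1 : ∀ n → Edge (Complete n 0) ↔ Fin 1
Complete[n,0]↔Fin1 n = mk↔ₛ′ (λ _ → 0F) (λ _ → ⊥ , ∣⊥∣≡0 n)
  (λ { 0F → refl ; (Fin.suc ()) })
  (λ (s , ∣s∣≡0) → Complete-simple (sym (∣p∣≡0⇒p≡⊥ s ∣s∣≡0)))

Complete[0,1+r]↔Fin0 : ∀ r → Edge (Complete 0 (suc r)) ↔ Fin 0
Complete[0,1+r]↔Fin0 r = mk↔ₛ′ (λ { ([] , ()) }) (λ ()) (λ ()) (λ { ([] , ()) })

Complete[1+n,1+r]↔⊎ : ∀ n r →
  Edge (Complete (suc n) (suc r)) ↔ (Edge (Complete n r) ⊎ Edge (Complete n (suc r)))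
Complete[1+n,1+r]↔⊎ n r = mk↔ₛ′ to from to∘from (Complete-simple ∘ from∘to)
  where
  to : Edge (Complete (suc n) (suc r)) → Edge (Complete n r) ⊎ Edge (Complete n (suc r))
  to (inside  ∷ s , ∣s∣≡r) = inj₁ (s , suc-injective ∣s∣≡r)
  to (outside ∷ s , ∣s∣≡r) = inj₂ (s , ∣s∣≡r)

  from : Edge (Complete n r) ⊎ Edge (Complete n (suc r)) → Edge (Complete (suc n) (suc r))
  from (inj₁ (s , ∣s∣≡r)) = inside  ∷ s , cong suc ∣s∣≡r
  from (inj₂ (s , ∣s∣≡r)) = outside ∷ s , ∣s∣≡r

  to∘from : ∀ e → to (from e) ≡ e
  to∘from (inj₁ e) = cong inj₁ (Complete-simple refl)
  to∘from (inj₂ e) = refl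

  from∘to : ∀ e → proj₁ (from (to e)) ≡ proj₁ e
  from∘to (inside  ∷ s , _) = refl
  from∘to (outside ∷ s , _) = refl

Complete↔Fin[binomial] : ∀ n r → Edge (Complete n r) ↔ Fin (binomial n r)
Complete↔Fin[binomial] n       zero    = Complete[n,0]↔Fin1 n
Complete↔Fin[binomial] zero    (suc r) = Complete[0,1+r]↔Fin0 r
Complete↔Fin[binomial] (suc n) (suc r) = ↔-trans (Complete[1+n,1+r]↔⊎ n r)
  (↔-trans (Complete↔Fin[binomial] n r ⊎-↔ Complete↔Fin[binomial] n (suc r)) (↔-sym +↔⊎))

Complete↔Fin[C] : ∀ n r → Edge (Complete n r) ↔ Fin (n C r)
Complete↔Fin[C] n r =
  subst (λ m → Edge (Complete n r) ↔ Fin m) (binomial≡C n r) (Complete↔Fin[binomial] n r)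

Complete-inhabited : ∀ {n r} → r ≤ n → Edge (Complete n r)
Complete-inhabited {n}     {zero}  _         = ⊥ , ∣⊥∣≡0 n
Complete-inhabited {suc n} {suc r} (s≤s r≤n) =
  Inverse.from (Complete[1+n,1+r]↔⊎ n r) (inj₁ (Complete-inhabited r≤n))

theorem9 : (n r : ℕ) → 1 ≤ r → r ≤ n → n / 2 < r →
           IsTotalEdgeDomaticNumber (Complete n r) ((n C r) / 2)
theorem9 n r _ r≤n n/2<r = lower , upper
  where
  enumeration : Edge (Complete n r) ↔ Fin (n C r)
  enumeration = Complete↔Fin[C] n r

  intersecting : Intersecting (Complete n r)
  intersecting = Complete-intersecting (m/n<o⇒m<o*n n 2 n/2<r)

  lower : (n C r) / 2 ≡ 0 ⊎ TEDPartition (Complete n r) ((n C r) / 2)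
  lower with (n C r) / 2 | m/n*n≤m (n C r) 2
  ... | zero  | _        = inj₁ refl
  ... | suc d | 2[1+d]≤m =
    inj₂ (TEDPartition-pairUp Complete-simple intersecting enumeration 2[1+d]≤m)

  upper : ∀ k → TEDPartition (Complete n r) k → k ≤ (n C r) / 2
  upper k partition =
    m*n≤o⇒m≤o/n k 2 (TEDPartition⇒*2≤ (↔⇒↣ enumeration) (Complete-inhabited r≤n) partition)
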